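{- Let $(M,\mathcal{C},\mathcal{C}^*)$ be an orthogonally oriented matroid on $E=X\,\dot\cup\,F\,\dot\cup\,G$ and $N=M/F\setminus G$. (1) If $\underline{C'}$ is a circuit of $N$, then there is $C\in\mathcal{C}$ with $\underline{C'}\subseteq\underline{C}\subseteq\underline{C'}\cup F$, and for any two $C,D\in\mathcal{C}$ with $\underline{C'}\subseteq\underline{C},\underline{D}\subseteq\underline{C'}\cup F$ one has $C|_{\underline{C'}}=D|_{\underline{C'}}$ or $C|_{\underline{C'}}=-D|_{\underline{C'}}$; hence setting the signings of $\underline{C'}$ to be $C|_{\underline{C'}}$ and $-C|_{\underline{C'}}$ is well defined. (2) Dually, if $\underline{U'}$ is a cocircuit of $N$, there is $U\in\mathcal{C}^*$ with $\underline{U'}\subseteq\underline{U}\subseteq\underline{U'}\cup G$, and for any two such $U,V\in\mathcal{C}^*$ one has $U|_{\underline{U'}}=\pm V|_{\underline{U'}}$. Consequently $\mathcal{C}$ and $\mathcal{C}^*$ induce in this way a circuit signature and a cocircuit signature on $N$.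
   Context: Matroids are in the sense of Bruhn, Diestel, Kriesell, Pendavingh and Wollan (possibly infinite ground set); cocircuits are circuits of the dual $M^*$; minors as usual. A signed subset $X$ of $E$ is a support $\underline{X}\subseteq E$ with a partition $(X^+,X^-)$; $X(e)=\pm1$ according as $e\in X^\pm$; $-X$ swaps the parts; $X|_A$ has parts $X^\pm\cap A$. $X,Y$ are orthogonal if $\underline{X}\cap\underline{Y}=\emptyset$ or there are $e,f\in\underline{X}\cap\underline{Y}$ with $X(e)Y(e)=-X(f)Y(f)$. A circuit signature of $M$ is a set of signed subsets consisting of exactly two opposite signed subsets supported by each circuit of $M$; a cocircuit signature is a circuit signature of $M^*$. $(M,\mathcal{C},\mathcal{C}^*)$ is an orthogonally oriented matroid if $\mathcal{C}$ is a circuit signature, $\mathcal{C}^*$ a cocircuit signature of $M$, and every element of $\mathcal{C}$ is orthogonal to every element of $\mathcal{C}^*$. -}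

module Defs where

open import Level using (Level; _⊔_; Setω) renaming (suc to lsuc; zero to lzero)
open import Data.Product using (Σ; _×_; _,_; ∃)
open import Data.Sum using (_⊎_)
open import Data.Empty using (⊥)
open import Relation.Nullary using (¬_; Dec)
open import Relation.Binary.PropositionalEquality using (_≡_)

Subset : Set → Set₁
Subset E = E → Set

module _ {E : Set} where

  ∅ : Subset E
  ∅ _ = ⊥

  ｛_｝ : E → Subset E
  ｛ x ｝ e = e ≡ x

  _⊆_ : Subset E → Subset E → Set
  A ⊆ B = ∀ e → A e → B e

  _≐_ : Subset E → Subset E → Set
  A ≐ B = (A ⊆ B) × (B ⊆ A)

  _∪_ : Subset E → Subset E → Subset E
  (A ∪ B) e = A e ⊎ B e

  _∩_ : Subset E → Subset E → Subset E
  (A ∩ B) e = A e × B e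

  _∖_ : Subset E → Subset E → Subset E
  (A ∖ B) e = A e × ¬ B e

  Disjoint : Subset E → Subset E → Set
  Disjoint A B = ∀ e → A e → B e → ⊥

  Maximal : (Subset E → Set₁) → Subset E → Set₁
  Maximal P I = P I × (∀ J → P J → I ⊆ J → J ⊆ I)

-- Matroids in the sense of Bruhn–Diestel–Kriesell–Pendavingh–Wollan,
-- on the ground set E (the whole type), via the independence axioms
-- (I1),(I2),(I3),(IM).

record Matroid (E : Set) : Set₂ where
  field
    Ind : Subset E → Set₁
    I1  : Ind ∅
    I2  : ∀ A B → A ⊆ B → Ind B → Ind A
    I3  : ∀ I I' → Ind I → ¬ Maximal Ind I → Maximal Ind I' →
          Σ E λ x → I' x × ¬ I x × Ind (I ∪ ｛ x ｝)
    IM  : ∀ I X → Ind I → I ⊆ X →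
          Σ (Subset E) λ J → Maximal (λ K → Ind K × I ⊆ K × K ⊆ X) J

module _ {E : Set} where

  IsCircuit : (S : Subset E) → (Subset E → Set₁) → Subset E → Set₁
  IsCircuit S Ind C =
    (C ⊆ S) × ¬ Ind C × (∀ D → D ⊆ C → ¬ (C ⊆ D) → Ind D)

  -- restriction to T (deletion of S ∖ T)
  restrictInd : (Subset E → Set₁) → Subset E → (Subset E → Set₁)
  restrictInd Ind T I = Lift′ (I ⊆ T) × Ind I
    where
      Lift′ : Set → Set₁
      Lift′ A = Level.Lift (lsuc lzero) A

  dualInd : (S : Subset E) → (Subset E → Set₁) → (Subset E → Set₁)
  dualInd S Ind I =
    Level.Lift (lsuc lzero) (I ⊆ S) ×
    Σ (Subset E) λ B → Maximal (λ K → Ind K × Level.Lift (lsuc lzero) (K ⊆ S)) B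
                      × Level.Lift (lsuc lzero) (Disjoint I B)

  -- contraction of F from the matroid on S:  M/F = (M* ∖ F)*,
  -- a matroid on ground set S ∖ F
  contractInd : (S F : Subset E) → (Subset E → Set₁) → (Subset E → Set₁)
  contractInd S F Ind =
    dualInd (S ∖ F) (restrictInd (dualInd S Ind) (S ∖ F))

record SignedSubset (E : Set) : Set₁ where
  constructor signed
  field
    pos  : Subset E
    neg  : Subset E
    disj : Disjoint pos neg

open SignedSubset public

module _ {E : Set} where

  support : SignedSubset E → Subset E
  support X = pos X ∪ neg X

  opp : SignedSubset E → SignedSubset E
  opp (signed p n d) = signed n p (λ e x y → d e y x)

  restrictSigned : SignedSubset E → Subset E → SignedSubset E
  restrictSigned (signed p n d) A =
    signed (p ∩ A) (n ∩ A) (λ e x y → d e (Data.Product.proj₁ x) (Data.Product.proj₁ y))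
    where import Data.Product

  _≃_ : SignedSubset E → SignedSubset E → Set
  X ≃ Y = (pos X ≐ pos Y) × (neg X ≐ neg Y)

  Agree : SignedSubset E → SignedSubset E → E → Set
  Agree X Y e = (pos X e × pos Y e) ⊎ (neg X e × neg Y e)

  Disagree : SignedSubset E → SignedSubset E → E → Set
  Disagree X Y e = (pos X e × neg Y e) ⊎ (neg X e × pos Y e)

  Orthogonal : SignedSubset E → SignedSubset E → Set
  Orthogonal X Y =
    Disjoint (support X) (support Y) ⊎
    Σ E λ e → Σ E λ f → Agree X Y e × Disagree X Y f

  record IsSignature (Circ : Subset E → Set₁)
                     (Sig : SignedSubset E → Set₁) : Set₁ where
    field
      supp-circ : ∀ X → Sig X → Circ (support X)
      cover     : ∀ C → Circ C → Σ (SignedSubset E) λ X → Sig X × (support X ≐ C)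
      opp-closed : ∀ X → Sig X → Sig (opp X)
      two        : ∀ X Y → Sig X → Sig Y → support X ≐ support Y →
                   (X ≃ Y) ⊎ (X ≃ opp Y)

module _ {E : Set} (M : Matroid E) where
  open Matroid M

  univ : Subset E
  univ _ = Level.Lift lzero (Level.Lift lzero ⊤′)
    where open import Data.Unit using () renaming (⊤ to ⊤′)

  Circuit : Subset E → Set₁
  Circuit = IsCircuit univ Ind

  Cocircuit : Subset E → Set₁
  Cocircuit = IsCircuit univ (dualInd univ Ind)

  record IsOrthogonallyOriented (𝒞 𝒞* : SignedSubset E → Set₁) : Set₁ where
    field
      circSig   : IsSignature Circuit 𝒞
      cocircSig : IsSignature Cocircuit 𝒞*
      orth      : ∀ X Y → 𝒞 X → 𝒞* Y → Orthogonal X Y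

  -- The minor N = M / F ∖ G on ground set X (for a partition E = X ⊔ F ⊔ G)
  module Minor (X F G : Subset E) where

    IndN : Subset E → Set₁
    IndN = restrictInd (contractInd univ F Ind) X

    CircuitN : Subset E → Set₁
    CircuitN = IsCircuit X IndN

    CocircuitN : Subset E → Set₁
    CocircuitN = IsCircuit X (dualInd X IndN)

    inducedSig : (𝒞 : SignedSubset E → Set₁) → SignedSubset E → Set₁
    inducedSig 𝒞 X' =
      CircuitN (support X') ×
      Σ (SignedSubset E) λ C → 𝒞 C ×
        Level.Lift (lsuc lzero)
          ((support X' ⊆ support C) × (support C ⊆ (support X' ∪ F)) ×
           (X' ≃ restrictSigned C (support X')))

    inducedCosig : (𝒞* : SignedSubset E → Set₁) → SignedSubset E → Set₁
    inducedCosig 𝒞* U' =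
      CocircuitN (support U') ×
      Σ (SignedSubset E) λ U → 𝒞* U ×
        Level.Lift (lsuc lzero)
          ((support U' ⊆ support U) × (support U ⊆ (support U' ∪ G)) ×
           (U' ≃ restrictSigned U (support U')))

LEM : Setω
LEM = ∀ {ℓ : Level} (P : Set ℓ) → Dec P

IsPartition3 : {E : Set} → Subset E → Subset E → Subset E → Set
IsPartition3 {E} X F G =
  (∀ e → X e ⊎ F e ⊎ G e) × Disjoint X F × Disjoint X G × Disjoint F G

-- Fix a basis BF of F.  A set I ⊆ X is independent in N = M/F∖G iff I ∪ BF is
-- independent in M, and the bases of N are the sets L ∩ X for the bases L ⊇ BF of
-- X ∪ F.  A circuit C′ of N therefore lifts to the fundamental circuit of any e ∈ C′
-- over (C′ ∖ {e}) ∪ BF, which lies between C′ and C′ ∪ F.  A cocircuit U′ of N lifts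
-- to the fundamental cocircuit of f ∈ U′ over a base extending a basis L ⊇ BF of
-- X ∪ F with U′ ∩ L = {f}; it avoids F, meets X inside U′ by basis exchange in L,
-- and contains U′ because otherwise minimality of U′ produces a base avoiding it.
--
-- For the signs take e ≠ f in C′.  The fundamental cocircuit of f over a base
-- containing (C′ ∖ {e}) ∪ BF meets every lift of C′ exactly in {e, f}, so by
-- orthogonality every lift C satisfies C(e)R(e) = −C(f)R(f) for a fixed signing R of
-- it.  Hence two lifts agree at f iff they agree at e, and their restrictions to C′
-- coincide up to sign.  Dually, for e ≠ f in U′ the fundamental circuit of f over
-- the base isolating e meets every lift of U′ exactly in {e, f}.

module Submission where

open import Defs
open import Level using (Lift; lift) renaming (suc to lsuc; zero to lzero)
open import Data.Product using (Σ; ∃; _×_; _,_; proj₁; proj₂; uncurry)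
open import Data.Sum using (_⊎_; inj₁; inj₂; [_,_]) renaming (map to map⊎)
open import Data.Empty using (⊥; ⊥-elim)
open import Data.Unit using (tt)
open import Function using (id; _∘_)
open import Relation.Binary.Bundles using (Setoid)
import Relation.Binary.Reasoning.Setoid as SetoidReasoning
open import Relation.Nullary using (¬_; yes; no)
open import Relation.Nullary.Decidable using (True; toWitness; fromWitness; decidable-stable)
open import Relation.Binary.PropositionalEquality using (_≡_; _≢_; refl; sym; subst)

module Classical (lem : LEM) where

  ¬¬-elim : ∀ {ℓ} {P : Set ℓ} → ¬ ¬ P → P
  ¬¬-elim = decidable-stable (lem _)

  -- A proposition of any level squashed into Set, so that subsets of the
  -- ground set can be carved out by the Set₁-valued independence predicate.
  Holds : ∀ {ℓ} → Set ℓ → Set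
  Holds P = True (lem P)

  ⊈⇒∃ : ∀ {E : Set} {A B : Subset E} → ¬ (A ⊆ B) → ∃ λ e → A e × ¬ B e
  ⊈⇒∃ A⊈B = ¬¬-elim λ none → A⊈B λ e Ae → ¬¬-elim λ ¬Be → none (e , Ae , ¬Be)

module _ {E : Set} where

  dualInd-⊆-closed : ∀ {S P} {A B : Subset E} → A ⊆ B → dualInd S P B → dualInd S P A
  dualInd-⊆-closed A⊆B (lift B⊆S , K , maxK , lift B∩K=∅) =
    lift (λ e Ae → B⊆S e (A⊆B e Ae)) , K , maxK , lift λ e Ae → B∩K=∅ e (A⊆B e Ae)

  restrictInd-⊆-closed : ∀ {P T} → (∀ {A B} → A ⊆ B → P B → P A) →
                         ∀ {A B : Subset E} → A ⊆ B → restrictInd P T B → restrictInd P T A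
  restrictInd-⊆-closed P-closed A⊆B (lift B⊆T , PB) = lift (λ e Ae → B⊆T e (A⊆B e Ae)) , P-closed A⊆B PB

  IsCircuit-resp-≐ : ∀ {S P} → (∀ {A B} → A ⊆ B → P B → P A) →
                     ∀ (A B : Subset E) → IsCircuit S P A → A ≐ B → IsCircuit S P B
  IsCircuit-resp-≐ P-closed A B (A⊆S , ¬PA , minimal) (A⊆B , B⊆A) =
    (λ e Be → A⊆S e (B⊆A e Be)) ,
    (λ PB → ¬PA (P-closed A⊆B PB)) ,
    (λ D D⊆B B⊈D → minimal D (λ e De → B⊆A e (D⊆B e De)) λ A⊆D → B⊈D λ e Be → A⊆D e (B⊆A e Be))

module MatroidTheory (lem : LEM) {E : Set} (M : Matroid E) where
  open Classical lem
  open Matroid M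

  ∈-univ : ∀ a → univ M a
  ∈-univ _ = lift (lift tt)

  ⊆-univ : {A : Subset E} → A ⊆ univ M
  ⊆-univ a _ = ∈-univ a

  ∪｛｝-⊆ : ∀ {I J : Subset E} {y} → I ⊆ J → J y → (I ∪ ｛ y ｝) ⊆ J
  ∪｛｝-⊆ I⊆J Jy a (inj₁ Ia) = I⊆J a Ia
  ∪｛｝-⊆ I⊆J Jy a (inj₂ refl) = Jy

  Base : Subset E → Set₁
  Base = Maximal Ind

  -- The form in which bases occur in dualInd (univ M) Ind.
  UnivBase : Subset E → Set₁
  UnivBase = Maximal (λ K → Ind K × Lift (lsuc lzero) (K ⊆ univ M))

  UnivBase⇒Base : ∀ {B} → UnivBase B → Base B
  UnivBase⇒Base ((indB , _) , maxB) = indB , λ J indJ B⊆J → maxB J (indJ , lift ⊆-univ) B⊆J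

  Base⇒UnivBase : ∀ {B} → Base B → UnivBase B
  Base⇒UnivBase (indB , maxB) = (indB , lift ⊆-univ) , λ J indJ B⊆J → maxB J (proj₁ indJ) B⊆J

  base-closed : ∀ {B y} → Base B → Ind (B ∪ ｛ y ｝) → B y
  base-closed (_ , maxB) indBy = maxB _ indBy (λ _ → inj₁) _ (inj₂ refl)

  base-∖-not-base : ∀ {B y} → Base B → B y → ¬ Base (B ∖ ｛ y ｝)
  base-∖-not-base (indB , _) By (_ , maximal-B-y) = proj₂ (maximal-B-y _ indB (λ _ → proj₁) _ By) refl

  record Basis (S I : Subset E) : Set₁ where
    field
      independent : Ind I
      ⊆S          : I ⊆ S
      maximal     : ∀ J → Ind J → J ⊆ S → I ⊆ J → J ⊆ I
  open Basis public

  basis-closed : ∀ {S I y} → Basis S I → S y → Ind (I ∪ ｛ y ｝) → I y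
  basis-closed basisI Sy indIy =
    maximal basisI _ indIy (∪｛｝-⊆ (⊆S basisI) Sy) (λ _ → inj₁) _ (inj₂ refl)

  ∩-⊆-basis : ∀ {S L B a} → Basis S L → L ⊆ B → Ind B → S a → B a → L a
  ∩-⊆-basis basisL L⊆B indB Sa Ba = basis-closed basisL Sa (I2 _ _ (∪｛｝-⊆ L⊆B Ba) indB)

  basis-∖-not-basis : ∀ {S I y} → Ind I → I ⊆ S → I y → ¬ Basis S (I ∖ ｛ y ｝)
  basis-∖-not-basis indI I⊆S Iy basis =
    proj₂ (maximal basis _ indI I⊆S (λ _ → proj₁) _ Iy) refl

  Basis-univ⇒Base : ∀ {B} → Basis (univ M) B → Base B
  Basis-univ⇒Base basisB = independent basisB , λ J indJ → maximal basisB J indJ ⊆-univ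

  basis-extension : ∀ {I} S → Ind I → I ⊆ S → ∃ λ J → Basis S J × I ⊆ J
  basis-extension S indI I⊆S with IM _ S indI I⊆S
  ... | J , ((indJ , I⊆J , J⊆S) , maxJ) =
    J , record { independent = indJ ; ⊆S = J⊆S
               ; maximal = λ K indK K⊆S J⊆K → maxJ K (indK , (λ a Ia → J⊆K a (I⊆J a Ia)) , K⊆S) J⊆K }
      , I⊆J

  base-extension : ∀ {I} → Ind I → ∃ λ B → Base B × I ⊆ B
  base-extension indI with basis-extension (univ M) indI ⊆-univ
  ... | B , basisB , I⊆B = B , Basis-univ⇒Base basisB , I⊆B

  non-basis-augmentation : ∀ {S I} → Ind I → I ⊆ S → ¬ Basis S I →
                           ∃ λ z → S z × ¬ I z × Ind (I ∪ ｛ z ｝)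
  non-basis-augmentation indI I⊆S ¬basis = ¬¬-elim λ none → ¬basis record
    { independent = indI ; ⊆S = I⊆S
    ; maximal = λ J indJ J⊆S I⊆J e Je → ¬¬-elim λ ¬Ie →
        none (e , J⊆S e Je , ¬Ie , I2 _ J (∪｛｝-⊆ I⊆J Je) indJ) }

  basis-of-spanning⇒base : ∀ {T J B₀} → Basis T J → B₀ ⊆ T → Base B₀ → Base J
  basis-of-spanning⇒base {J = J} basisJ B₀⊆T baseB₀ with lem (Base J)
  ... | yes baseJ = baseJ
  ... | no ¬baseJ with I3 J _ (independent basisJ) ¬baseJ baseB₀
  ... | x , B₀x , ¬Jx , indJx = ⊥-elim (¬Jx (basis-closed basisJ (B₀⊆T x B₀x) indJx))

  Base⇒Basis-univ : ∀ {B} → Base B → Basis (univ M) B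
  Base⇒Basis-univ (indB , maxB) =
    record { independent = indB ; ⊆S = ⊆-univ ; maximal = λ J indJ _ → maxB J indJ }

  base-∖S-rigid : ∀ {S I′ B′ J} → Basis S I′ → Base B′ → I′ ⊆ B′ → Base J →
                  (∀ a → J a → ¬ S a → B′ a) → ∀ a → B′ a → ¬ S a → J a
  base-∖S-rigid {S} {I′} {B′} {J} basisI′ baseB′ I′⊆B′ baseJ J∖S⊆B′ a B′a ¬Sa =
    [ (λ I′a → ⊥-elim (¬Sa (⊆S basisI′ a I′a))) , proj₁ ] (B′⊆L a B′a)
    where
    L : Subset E
    L = I′ ∪ (J ∖ S)
    L⊆B′ : L ⊆ B′
    L⊆B′ b = [ I′⊆B′ b , (λ (Jb , ¬Sb) → J∖S⊆B′ b Jb ¬Sb) ]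
    baseL : Base L
    baseL with lem (Base L)
    ... | yes b = b
    ... | no ¬b with I3 L J (I2 L B′ L⊆B′ (proj₁ baseB′)) ¬b baseJ
    ... | x , Jx , ¬Lx , indLx with lem (S x)
    ... | yes Sx = ⊥-elim (¬Lx (inj₁ (basis-closed basisI′ Sx (I2 _ _ I′x⊆Lx indLx))))
      where
      I′x⊆Lx : (I′ ∪ ｛ x ｝) ⊆ (L ∪ ｛ x ｝)
      I′x⊆Lx b = [ (λ I′b → inj₁ (inj₁ I′b)) , inj₂ ]
    ... | no ¬Sx = ⊥-elim (¬Lx (inj₂ (Jx , ¬Sx)))
    B′⊆L : B′ ⊆ L
    B′⊆L = proj₂ baseL B′ (proj₁ baseB′) L⊆B′

  -- (I3) for the restriction M|S.  If no element of I′ augmented I then, with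
  -- R = B′ ∖ S, a basis J of I ∪ B′ would be a base inside I ∪ R, whereas extending
  -- I ∪ ｛ z ｝ inside (I ∪ ｛ z ｝) ∪ R yields a base containing J and z.
  basis-augmentation : ∀ {S I I′} → Ind I → I ⊆ S → ¬ Basis S I → Basis S I′ →
                       ∃ λ x → I′ x × ¬ I x × Ind (I ∪ ｛ x ｝)
  basis-augmentation {S} {I} {I′} indI I⊆S ¬basisI basisI′
    with non-basis-augmentation indI I⊆S ¬basisI | base-extension (independent basisI′)
  ... | z , Sz , ¬Iz , indIz | B′ , baseB′ , I′⊆B′ = ¬¬-elim no-augmentation-⊥
    where
    R : Subset E
    R = B′ ∖ S
    no-augmentation-⊥ : ¬ (∃ λ x → I′ x × ¬ I x × Ind (I ∪ ｛ x ｝)) → ⊥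
    no-augmentation-⊥ none
      with basis-extension (I ∪ B′) indI (λ _ → inj₁)
    ... | J , basisJ , I⊆J
      with basis-extension ((I ∪ ｛ z ｝) ∪ R) indIz (λ _ → inj₁)
    ... | J′ , basisJ′ , Iz⊆J′ =
      [ ¬Iz , (λ Rz → proj₂ Rz Sz) ] (J⊆I∪R z (J′⊆J z (Iz⊆J′ z (inj₂ refl))))
      where
      J⊆I∪R : J ⊆ (I ∪ R)
      J⊆I∪R a Ja with lem (I a) | ⊆S basisJ a Ja
      ... | yes Ia | _ = inj₁ Ia
      ... | no ¬Ia | inj₁ Ia = ⊥-elim (¬Ia Ia)
      ... | no ¬Ia | inj₂ B′a with lem (S a)
      ... | no ¬Sa = inj₂ (B′a , ¬Sa)
      ... | yes Sa = ⊥-elim (none (a , I′a , ¬Ia , I2 _ J (∪｛｝-⊆ I⊆J Ja) (independent basisJ)))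
        where
        I′a : I′ a
        I′a = basis-closed basisI′ Sa (I2 _ B′ (∪｛｝-⊆ I′⊆B′ B′a) (proj₁ baseB′))
      outside-S : ∀ a → ((I ∪ ｛ z ｝) ∪ R) a → ¬ S a → B′ a
      outside-S a (inj₁ (inj₁ Ia)) ¬Sa = ⊥-elim (¬Sa (I⊆S a Ia))
      outside-S a (inj₁ (inj₂ refl)) ¬Sa = ⊥-elim (¬Sa Sz)
      outside-S a (inj₂ (B′a , _)) _ = B′a
      baseJ : Base J
      baseJ = basis-of-spanning⇒base basisJ (λ _ → inj₂) baseB′
      baseJ′ : Base J′
      baseJ′ = basis-of-spanning⇒base basisJ′
                 (λ a Ja → [ (λ Ia → inj₁ (inj₁ Ia)) , inj₂ ] (J⊆I∪R a Ja)) baseJ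
      R⊆J′ : R ⊆ J′
      R⊆J′ a (B′a , ¬Sa) = base-∖S-rigid basisI′ baseB′ I′⊆B′ baseJ′
                             (λ b J′b → outside-S b (⊆S basisJ′ b J′b)) a B′a ¬Sa
      J′⊆J : J′ ⊆ J
      J′⊆J = proj₂ baseJ J′ (independent basisJ′)
               λ a Ja → [ (λ Ia → Iz⊆J′ a (inj₁ Ia)) , R⊆J′ a ] (J⊆I∪R a Ja)

  basis-exchange : ∀ {S L f y} → Basis S L → L f → S y → ¬ L y →
                   Ind ((L ∖ ｛ f ｝) ∪ ｛ y ｝) → Basis S ((L ∖ ｛ f ｝) ∪ ｛ y ｝)
  basis-exchange {S} {L} {f} {y} basisL Lf Sy ¬Ly indL′ with lem (Basis S ((L ∖ ｛ f ｝) ∪ ｛ y ｝))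
  ... | yes basisL′ = basisL′
  ... | no ¬basisL′
    with basis-augmentation indL′ (λ a → [ (λ (La , _) → ⊆S basisL a La) , (λ { refl → Sy }) ])
                            ¬basisL′ basisL
  ... | w , Lw , ¬L′w , indL′w = ⊥-elim (¬Ly (basis-closed basisL Sy (I2 _ _ Ly⊆L′w indL′w)))
    where
    Ly⊆L′w : (L ∪ ｛ y ｝) ⊆ (((L ∖ ｛ f ｝) ∪ ｛ y ｝) ∪ ｛ w ｝)
    Ly⊆L′w a (inj₂ a≡y) = inj₁ (inj₂ a≡y)
    Ly⊆L′w a (inj₁ La) with lem (a ≡ f)
    ... | no a≢f = inj₁ (inj₁ (La , a≢f))
    ... | yes refl = inj₂ (sym (¬¬-elim λ w≢f → ¬L′w (inj₁ (Lw , w≢f))))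

  base-exchange : ∀ {B f y} → Base B → B f → ¬ B y →
                  Ind ((B ∖ ｛ f ｝) ∪ ｛ y ｝) → Base ((B ∖ ｛ f ｝) ∪ ｛ y ｝)
  base-exchange {y = y} baseB Bf ¬By indB′ =
    Basis-univ⇒Base (basis-exchange (Base⇒Basis-univ baseB) Bf (∈-univ y) ¬By indB′)

  basis-completion : ∀ {S L B} → Basis S L → Base B → ∃ λ B′ → Base B′ × L ⊆ B′ × B′ ⊆ (L ∪ (B ∖ S))
  basis-completion {S} {L} {B} basisL baseB
    with basis-extension (L ∪ (B ∖ S)) (independent basisL) (λ _ → inj₁)
  ... | B′ , basisB′ , L⊆B′ = B′ , baseB′ , L⊆B′ , ⊆S basisB′
    where
    baseB′ : Base B′
    baseB′ with lem (Base B′)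
    ... | yes b = b
    ... | no ¬b with I3 B′ B (independent basisB′) ¬b baseB
    ... | w , Bw , ¬B′w , indB′w with lem (S w)
    ... | yes Sw = ⊥-elim (¬B′w (L⊆B′ w (basis-closed basisL Sw (I2 _ _ Lw⊆B′w indB′w))))
      where
      Lw⊆B′w : (L ∪ ｛ w ｝) ⊆ (B′ ∪ ｛ w ｝)
      Lw⊆B′w a = [ (λ La → inj₁ (L⊆B′ a La)) , inj₂ ]
    ... | no ¬Sw = ⊥-elim (¬B′w (basis-closed basisB′ (inj₂ (Bw , ¬Sw)) indB′w))

  fundamental-circuit : Subset E → E → Subset E
  fundamental-circuit I x a = a ≡ x ⊎ (I a × Holds (Ind ((I ∖ ｛ a ｝) ∪ ｛ x ｝)))

  module _ {I : Subset E} {x : E} where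

    fundamental-circuit-⊆ : fundamental-circuit I x ⊆ (I ∪ ｛ x ｝)
    fundamental-circuit-⊆ a (inj₁ a≡x) = inj₂ a≡x
    fundamental-circuit-⊆ a (inj₂ (Ia , _)) = inj₁ Ia

    fundamental-circuit⁺ : ∀ {a} → I a → Ind ((I ∖ ｛ a ｝) ∪ ｛ x ｝) → fundamental-circuit I x a
    fundamental-circuit⁺ Ia ind = inj₂ (Ia , fromWitness ind)

    fundamental-circuit⁻ : ∀ {a} → fundamental-circuit I x a →
                           a ≡ x ⊎ (I a × Ind ((I ∖ ｛ a ｝) ∪ ｛ x ｝))
    fundamental-circuit⁻ (inj₁ a≡x) = inj₁ a≡x
    fundamental-circuit⁻ (inj₂ (Ia , h)) = inj₂ (Ia , toWitness h)

    fundamental-circuit-circuit : Ind I → ¬ Ind (I ∪ ｛ x ｝) → Circuit M (fundamental-circuit I x)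
    fundamental-circuit-circuit indI depIx = ⊆-univ , dependent , minimal
      where
      C : Subset E
      C = fundamental-circuit I x
      -- A basis J ⊇ C of I ∪ ｛ x ｝ misses some y ∈ I, and augmenting I ∖ ｛ y ｝
      -- from J can only add x; so I ∖ ｛ y ｝ ∪ ｛ x ｝ is independent and y ∈ C ⊆ J.
      dependent : ¬ Ind C
      dependent indC with basis-extension (I ∪ ｛ x ｝) indC fundamental-circuit-⊆
      ... | J , basisJ , C⊆J
        with ⊈⇒∃ (λ I⊆J → depIx (I2 _ J (∪｛｝-⊆ I⊆J (C⊆J x (inj₁ refl))) (independent basisJ)))
      ... | y , Iy , ¬Jy
        with basis-augmentation (I2 _ I (λ _ → proj₁) indI) (λ a I-y-a → inj₁ (proj₁ I-y-a))
                                (basis-∖-not-basis indI (λ _ → inj₁) Iy) basisJ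
      ... | w , Jw , ¬I-y-w , indI-y-w with ⊆S basisJ w Jw
      ... | inj₁ Iw = ¬Jy (subst J (¬¬-elim λ w≢y → ¬I-y-w (Iw , w≢y)) Jw)
      ... | inj₂ refl = ¬Jy (C⊆J y (fundamental-circuit⁺ Iy indI-y-w))
      minimal : ∀ D → D ⊆ C → ¬ (C ⊆ D) → Ind D
      minimal D D⊆C C⊈D with ⊈⇒∃ C⊈D
      ... | z , Cz , ¬Dz with fundamental-circuit⁻ Cz
      ... | inj₁ refl = I2 D I (λ d Dd → [ (λ { refl → ⊥-elim (¬Dz Dd) }) , proj₁ ] (D⊆C d Dd)) indI
      ... | inj₂ (Iz , indI-z+x) = I2 D _ D⊆I-z+x indI-z+x
        where
        D⊆I-z+x : D ⊆ ((I ∖ ｛ z ｝) ∪ ｛ x ｝)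
        D⊆I-z+x d Dd with D⊆C d Dd
        ... | inj₁ d≡x = inj₂ d≡x
        ... | inj₂ (Id , _) = inj₁ (Id , λ { refl → ¬Dz Dd })

    fundamental-circuit-⊆-basis : ∀ {S A} → Basis S A → A ⊆ I → S x → ¬ I x →
                                  fundamental-circuit I x ⊆ (A ∪ ｛ x ｝)
    fundamental-circuit-⊆-basis {A = A} basisA A⊆I Sx ¬Ix a Ca with fundamental-circuit⁻ Ca
    ... | inj₁ a≡x = inj₂ a≡x
    ... | inj₂ (Ia , indI-a+x) with lem (A a)
    ... | yes Aa = inj₁ Aa
    ... | no ¬Aa = ⊥-elim (¬Ix (A⊆I x (basis-closed basisA Sx (I2 _ _ Ax⊆I-a+x indI-a+x))))
      where
      Ax⊆I-a+x : (A ∪ ｛ x ｝) ⊆ ((I ∖ ｛ a ｝) ∪ ｛ x ｝)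
      Ax⊆I-a+x b (inj₁ Ab) = inj₁ (A⊆I b Ab , λ { refl → ¬Aa Ab })
      Ax⊆I-a+x b (inj₂ b≡x) = inj₂ b≡x

  fundamental-cocircuit : Subset E → E → Subset E
  fundamental-cocircuit B f a = a ≡ f ⊎ (¬ B a × Holds (Ind ((B ∖ ｛ f ｝) ∪ ｛ a ｝)))

  module _ {B : Subset E} {f : E} where

    fundamental-cocircuit⁻ : ∀ {a} → fundamental-cocircuit B f a →
                             a ≡ f ⊎ (¬ B a × Ind ((B ∖ ｛ f ｝) ∪ ｛ a ｝))
    fundamental-cocircuit⁻ (inj₁ a≡f) = inj₁ a≡f
    fundamental-cocircuit⁻ (inj₂ (¬Ba , h)) = inj₂ (¬Ba , toWitness h)

    fundamental-cocircuit-∩-base : ∀ {a} → fundamental-cocircuit B f a → B a → a ≡ f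
    fundamental-cocircuit-∩-base (inj₁ a≡f) _ = a≡f
    fundamental-cocircuit-∩-base (inj₂ (¬Ba , _)) Ba = ⊥-elim (¬Ba Ba)

    fundamental-cocircuit-cocircuit : Base B → B f → Cocircuit M (fundamental-cocircuit B f)
    fundamental-cocircuit-cocircuit baseB Bf = ⊆-univ , codependent , minimal
      where
      U : Subset E
      U = fundamental-cocircuit B f
      codependent : ¬ dualInd (univ M) Ind U
      codependent (_ , B′ , univB′ , lift U∩B′=∅)
        with I3 (B ∖ ｛ f ｝) B′ (I2 _ B (λ _ → proj₁) (proj₁ baseB))
                (base-∖-not-base baseB Bf) (UnivBase⇒Base univB′)
      ... | w , B′w , ¬B-f-w , indB-f+w = U∩B′=∅ w (inj₂ (¬Bw , fromWitness indB-f+w)) B′w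
        where
        ¬Bw : ¬ B w
        ¬Bw Bw = ¬B-f-w (Bw , λ { refl → U∩B′=∅ f (inj₁ refl) B′w })
      minimal : ∀ D → D ⊆ U → ¬ (U ⊆ D) → dualInd (univ M) Ind D
      minimal D D⊆U U⊈D with ⊈⇒∃ U⊈D
      ... | z , Uz , ¬Dz with fundamental-cocircuit⁻ Uz
      ... | inj₁ refl = lift ⊆-univ , B , Base⇒UnivBase baseB , lift D∩B=∅
        where
        D∩B=∅ : Disjoint D B
        D∩B=∅ d Dd Bd with fundamental-cocircuit-∩-base (D⊆U d Dd) Bd
        ... | refl = ¬Dz Dd
      ... | inj₂ (¬Bz , indB-f+z) =
        lift ⊆-univ , _ , Base⇒UnivBase (base-exchange baseB Bf ¬Bz indB-f+z) , lift D∩B-f+z=∅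
        where
        D∩B-f+z=∅ : Disjoint D ((B ∖ ｛ f ｝) ∪ ｛ z ｝)
        D∩B-f+z=∅ d Dd (inj₁ (Bd , d≢f)) = d≢f (fundamental-cocircuit-∩-base (D⊆U d Dd) Bd)
        D∩B-f+z=∅ d Dd (inj₂ refl) = ¬Dz Dd

    fundamental-cocircuit-∩-span : ∀ {S A} → Basis S A → A ⊆ B → ¬ S f →
                                   Disjoint (fundamental-cocircuit B f) S
    fundamental-cocircuit-∩-span {A = A} basisA A⊆B ¬Sf y Uy Sy with fundamental-cocircuit⁻ Uy
    ... | inj₁ refl = ¬Sf Sy
    ... | inj₂ (¬By , indB-f+y) = ¬By (A⊆B y (basis-closed basisA Sy (I2 _ _ Ay⊆B-f+y indB-f+y)))
      where
      Ay⊆B-f+y : (A ∪ ｛ y ｝) ⊆ ((B ∖ ｛ f ｝) ∪ ｛ y ｝)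
      Ay⊆B-f+y b (inj₁ Ab) = inj₁ (A⊆B b Ab , λ { refl → ¬Sf (⊆S basisA b Ab) })
      Ay⊆B-f+y b (inj₂ b≡y) = inj₂ b≡y

module SignedSubsets {E : Set} where

  module _ (X Y : SignedSubset E) {e : E} where

    agree-disagree-⊥ : Agree X Y e → Disagree X Y e → ⊥
    agree-disagree-⊥ (inj₁ (_ , pY)) (inj₁ (_ , nY)) = disj Y e pY nY
    agree-disagree-⊥ (inj₁ (pX , _)) (inj₂ (nX , _)) = disj X e pX nX
    agree-disagree-⊥ (inj₂ (nX , _)) (inj₁ (pX , _)) = disj X e pX nX
    agree-disagree-⊥ (inj₂ (_ , nY)) (inj₂ (_ , pY)) = disj Y e pY nY

    agree-or-disagree : support X e → support Y e → Agree X Y e ⊎ Disagree X Y e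
    agree-or-disagree (inj₁ pX) (inj₁ pY) = inj₁ (inj₁ (pX , pY))
    agree-or-disagree (inj₁ pX) (inj₂ nY) = inj₂ (inj₁ (pX , nY))
    agree-or-disagree (inj₂ nX) (inj₁ pY) = inj₂ (inj₂ (nX , pY))
    agree-or-disagree (inj₂ nX) (inj₂ nY) = inj₁ (inj₂ (nX , nY))

    agree-support : Agree X Y e → support X e × support Y e
    agree-support (inj₁ (pX , pY)) = inj₁ pX , inj₁ pY
    agree-support (inj₂ (nX , nY)) = inj₂ nX , inj₂ nY

    disagree-support : Disagree X Y e → support X e × support Y e
    disagree-support (inj₁ (pX , nY)) = inj₁ pX , inj₂ nY
    disagree-support (inj₂ (nX , pY)) = inj₂ nX , inj₁ pY

    agree-sym : Agree X Y e → Agree Y X e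
    agree-sym (inj₁ (pX , pY)) = inj₁ (pY , pX)
    agree-sym (inj₂ (nX , nY)) = inj₂ (nY , nX)

    disagree-sym : Disagree X Y e → Disagree Y X e
    disagree-sym (inj₁ (pX , nY)) = inj₂ (nY , pX)
    disagree-sym (inj₂ (nX , pY)) = inj₁ (pY , nX)

    agree-pos : Agree X Y e → pos X e → pos Y e
    agree-pos (inj₁ (_ , pY)) _ = pY
    agree-pos (inj₂ (nX , _)) pX = ⊥-elim (disj X e pX nX)

    agree-neg : Agree X Y e → neg X e → neg Y e
    agree-neg (inj₁ (pX , _)) nX = ⊥-elim (disj X e pX nX)
    agree-neg (inj₂ (_ , nY)) _ = nY

    disagree-pos : Disagree X Y e → pos X e → neg Y e
    disagree-pos (inj₁ (_ , nY)) _ = nY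
    disagree-pos (inj₂ (nX , _)) pX = ⊥-elim (disj X e pX nX)

    disagree-neg : Disagree X Y e → neg X e → pos Y e
    disagree-neg (inj₁ (pX , _)) nX = ⊥-elim (disj X e pX nX)
    disagree-neg (inj₂ (_ , pY)) _ = pY

  module _ (P Q R : SignedSubset E) {e : E} where

    agree-trans : Agree P Q e → Agree Q R e → Agree P R e
    agree-trans (inj₁ (pP , pQ)) aQR = inj₁ (pP , agree-pos Q R aQR pQ)
    agree-trans (inj₂ (nP , nQ)) aQR = inj₂ (nP , agree-neg Q R aQR nQ)

    disagree-trans : Disagree P Q e → Disagree Q R e → Agree P R e
    disagree-trans (inj₁ (pP , nQ)) dQR = inj₁ (pP , disagree-neg Q R dQR nQ)
    disagree-trans (inj₂ (nP , pQ)) dQR = inj₂ (nP , disagree-pos Q R dQR pQ)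

  Opposed : SignedSubset E → SignedSubset E → E → E → Set
  Opposed X Y e f = (Agree X Y e × Disagree X Y f) ⊎ (Disagree X Y e × Agree X Y f)

  opposed-sym : ∀ X Y {e f} → Opposed X Y e f → Opposed Y X e f
  opposed-sym X Y (inj₁ (a , d)) = inj₁ (agree-sym X Y a , disagree-sym X Y d)
  opposed-sym X Y (inj₂ (d , a)) = inj₂ (disagree-sym X Y d , agree-sym X Y a)

  opposed-agree : ∀ P Q R {e f} → Opposed P R e f → Opposed Q R e f → Agree P Q e → Agree P Q f
  opposed-agree P Q R (inj₁ (_ , dPRf)) (inj₁ (_ , dQRf)) _ =
    disagree-trans P R Q dPRf (disagree-sym Q R dQRf)
  opposed-agree P Q R (inj₁ (aPRe , _)) (inj₂ (dQRe , _)) aPQe =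
    ⊥-elim (agree-disagree-⊥ Q R (agree-trans Q P R (agree-sym P Q aPQe) aPRe) dQRe)
  opposed-agree P Q R (inj₂ (dPRe , _)) (inj₁ (aQRe , _)) aPQe =
    ⊥-elim (agree-disagree-⊥ P R (agree-trans P Q R aPQe aQRe) dPRe)
  opposed-agree P Q R (inj₂ (_ , aPRf)) (inj₂ (_ , aQRf)) _ =
    agree-trans P R Q aPRf (agree-sym Q R aQRf)

  orthogonal⇒opposed : ∀ X Y {e f} → Orthogonal X Y →
                       (∀ a → support X a → support Y a → a ≡ e ⊎ a ≡ f) →
                       support X f → support Y f → Opposed X Y e f
  orthogonal⇒opposed X Y (inj₁ X∩Y=∅) _ Xf Yf = ⊥-elim (X∩Y=∅ _ Xf Yf)
  orthogonal⇒opposed X Y (inj₂ (a , b , aXYa , dXYb)) ⊆ef _ _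
    with uncurry (⊆ef a) (agree-support X Y aXYa) | uncurry (⊆ef b) (disagree-support X Y dXYb)
  ... | inj₁ refl | inj₂ refl = inj₁ (aXYa , dXYb)
  ... | inj₂ refl | inj₁ refl = inj₂ (dXYb , aXYa)
  ... | inj₁ refl | inj₁ refl = ⊥-elim (agree-disagree-⊥ X Y aXYa dXYb)
  ... | inj₂ refl | inj₂ refl = ⊥-elim (agree-disagree-⊥ X Y aXYa dXYb)

  ≐-sym : {A B : Subset E} → A ≐ B → B ≐ A
  ≐-sym (A⊆B , B⊆A) = B⊆A , A⊆B

  ≐-trans : {A B C : Subset E} → A ≐ B → B ≐ C → A ≐ C
  ≐-trans (A⊆B , B⊆A) (B⊆C , C⊆B) = (λ e Ae → B⊆C e (A⊆B e Ae)) , (λ e Ce → B⊆A e (C⊆B e Ce))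

  ≃-setoid : Setoid (lsuc lzero) lzero
  ≃-setoid = record
    { Carrier = SignedSubset E
    ; _≈_ = _≃_
    ; isEquivalence = record
      { refl = ((λ _ p → p) , (λ _ p → p)) , ((λ _ n → n) , (λ _ n → n))
      ; sym = λ (p , n) → ≐-sym p , ≐-sym n
      ; trans = λ (p , n) (p′ , n′) → ≐-trans p p′ , ≐-trans n n′
      }
    }

  module ≃-Reasoning = SetoidReasoning ≃-setoid

  opp-cong : {P Q : SignedSubset E} → P ≃ Q → opp P ≃ opp Q
  opp-cong (p , n) = n , p

  restrict-cong : (C : SignedSubset E) {A B : Subset E} → A ≐ B → restrictSigned C A ≃ restrictSigned C B
  restrict-cong C (A⊆B , B⊆A) =
    ((λ e (pC , Ae) → pC , A⊆B e Ae) , (λ e (pC , Be) → pC , B⊆A e Be)) ,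
    ((λ e (nC , Ae) → nC , A⊆B e Ae) , (λ e (nC , Be) → nC , B⊆A e Be))

  support-opp : (X : SignedSubset E) → support (opp X) ≐ support X
  support-opp X = (λ _ → [ inj₂ , inj₁ ]) , (λ _ → [ inj₂ , inj₁ ])

  support-restrict-⊆ : (C : SignedSubset E) (A : Subset E) → support (restrictSigned C A) ⊆ support C
  support-restrict-⊆ C A _ = [ (λ (pC , _) → inj₁ pC) , (λ (nC , _) → inj₂ nC) ]

  support-restrict : (C : SignedSubset E) {A : Subset E} → A ⊆ support C →
                     support (restrictSigned C A) ≐ A
  support-restrict C A⊆C = (λ _ → [ proj₂ , proj₂ ]) , (λ a Aa → map⊎ (_, Aa) (_, Aa) (A⊆C a Aa))

  module _ (P Q : SignedSubset E) (A : Subset E) where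

    restrict-agree : (∀ a → A a → Agree P Q a) → restrictSigned P A ≃ restrictSigned Q A
    restrict-agree agree =
      ((λ a (pP , Aa) → agree-pos P Q (agree a Aa) pP , Aa) ,
       (λ a (pQ , Aa) → agree-pos Q P (agree-sym P Q (agree a Aa)) pQ , Aa)) ,
      ((λ a (nP , Aa) → agree-neg P Q (agree a Aa) nP , Aa) ,
       (λ a (nQ , Aa) → agree-neg Q P (agree-sym P Q (agree a Aa)) nQ , Aa))

    restrict-disagree : (∀ a → A a → Disagree P Q a) → restrictSigned P A ≃ opp (restrictSigned Q A)
    restrict-disagree disagree =
      ((λ a (pP , Aa) → disagree-pos P Q (disagree a Aa) pP , Aa) ,
       (λ a (nQ , Aa) → disagree-neg Q P (disagree-sym P Q (disagree a Aa)) nQ , Aa)) ,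
      ((λ a (nP , Aa) → disagree-neg P Q (disagree a Aa) nP , Aa) ,
       (λ a (pQ , Aa) → disagree-pos Q P (disagree-sym P Q (disagree a Aa)) pQ , Aa))

    restrict-≃-or-opp : LEM → A ⊆ support P → A ⊆ support Q →
                        (∀ e f → A e → A f → e ≢ f → Agree P Q e → Agree P Q f) →
                        (restrictSigned P A ≃ restrictSigned Q A) ⊎
                        (restrictSigned P A ≃ opp (restrictSigned Q A))
    restrict-≃-or-opp lem A⊆P A⊆Q transfer with lem (∃ λ e → A e × Agree P Q e)
    ... | yes (e , Ae , agree) = inj₁ (restrict-agree λ a Aa → transfer′ a Aa)
      where
      transfer′ : ∀ a → A a → Agree P Q a
      transfer′ a Aa with lem (e ≡ a)
      ... | yes refl = agree
      ... | no e≢a = transfer e a Ae Aa e≢a agree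
    ... | no ¬agree = inj₂ (restrict-disagree disagree)
      where
      disagree : ∀ a → A a → Disagree P Q a
      disagree a Aa = [ (λ agree → ⊥-elim (¬agree (a , Aa , agree))) , id ]
                        (agree-or-disagree P Q (A⊆P a Aa) (A⊆Q a Aa))

  module _ (𝒟 : SignedSubset E → Set₁) (F′ : Subset E) where

    SignedLift : Subset E → Set₁
    SignedLift C′ = Σ (SignedSubset E) λ C → 𝒟 C × (C′ ⊆ support C) × (support C ⊆ (C′ ∪ F′))

    UniqueUpToSign : Subset E → Set₁
    UniqueUpToSign C′ =
      (C D : SignedSubset E) → 𝒟 C → 𝒟 D
      → (C′ ⊆ support C) → (support C ⊆ (C′ ∪ F′))
      → (C′ ⊆ support D) → (support D ⊆ (C′ ∪ F′))
      → (restrictSigned C C′ ≃ restrictSigned D C′) ⊎ (restrictSigned C C′ ≃ opp (restrictSigned D C′))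

    signed-lift : ∀ {Circ C′} → IsSignature Circ 𝒟 →
                  (∃ λ C₀ → Circ C₀ × C′ ⊆ C₀ × C₀ ⊆ (C′ ∪ F′)) → SignedLift C′
    signed-lift sig (C₀ , circC₀ , C′⊆C₀ , C₀⊆C′F′) with IsSignature.cover sig C₀ circC₀
    ... | C , 𝒟C , (C⊆C₀ , C₀⊆C) =
      C , 𝒟C , (λ a C′a → C₀⊆C a (C′⊆C₀ a C′a)) , (λ a Ca → C₀⊆C′F′ a (C⊆C₀ a Ca))

    unique-up-to-sign : LEM → ∀ {C′} →
                        (∀ e f → C′ e → C′ f → e ≢ f → Σ (SignedSubset E) λ R →
                           ∀ C → 𝒟 C → C′ ⊆ support C → support C ⊆ (C′ ∪ F′) → Opposed C R e f) →
                        UniqueUpToSign C′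
    unique-up-to-sign lem opposing C D 𝒟C 𝒟D C′⊆C C⊆C′F′ C′⊆D D⊆C′F′ =
      restrict-≃-or-opp C D _ lem C′⊆C C′⊆D λ e f C′e C′f e≢f →
        let (R , opposed) = opposing e f C′e C′f e≢f in
        opposed-agree C D R (opposed C 𝒟C C′⊆C C⊆C′F′) (opposed D 𝒟D C′⊆D D⊆C′F′)

  module _ (Circ : Subset E → Set₁) (F′ : Subset E) (𝒟 : SignedSubset E → Set₁) where

    Induced : SignedSubset E → Set₁
    Induced X′ =
      Circ (support X′) ×
      Σ (SignedSubset E) λ C → 𝒟 C ×
        Lift (lsuc lzero) ((support X′ ⊆ support C) × (support C ⊆ (support X′ ∪ F′)) ×
                           (X′ ≃ restrictSigned C (support X′)))

    module _ (resp : ∀ A B → Circ A → A ≐ B → Circ B) where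

      induced-cover : (∀ C′ → Circ C′ → SignedLift 𝒟 F′ C′) →
                      ∀ C′ → Circ C′ → Σ (SignedSubset E) λ X′ → Induced X′ × (support X′ ≐ C′)
      induced-cover lifts C′ circC′ with lifts C′ circC′
      ... | C , 𝒟C , C′⊆C , C⊆C′F′ =
        restrictSigned C C′ ,
        (resp C′ _ circC′ (≐-sym C′≐) , C , 𝒟C ,
         lift (support-restrict-⊆ C C′ , (λ a Ca → map⊎ (proj₂ C′≐ a) id (C⊆C′F′ a Ca)) ,
               restrict-cong C (≐-sym C′≐))) ,
        C′≐
        where
        C′≐ : support (restrictSigned C C′) ≐ C′
        C′≐ = support-restrict C C′⊆C

      induced-opp : (∀ C → 𝒟 C → 𝒟 (opp C)) → ∀ X′ → Induced X′ → Induced (opp X′)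
      induced-opp 𝒟-opp X′ (circX′ , C , 𝒟C , lift (X′⊆C , C⊆X′F′ , X′≃C)) =
        resp _ _ circX′ (≐-sym (support-opp X′)) , opp C , 𝒟-opp C 𝒟C ,
        lift ((λ a s → proj₂ (support-opp C) a (X′⊆C a (proj₁ (support-opp X′) a s))) ,
              (λ a s → map⊎ (proj₂ (support-opp X′) a) id (C⊆X′F′ a (proj₁ (support-opp C) a s))) ,
              (begin
                 opp X′ ≈⟨ opp-cong {P = X′} {Q = RC} X′≃C ⟩
                 opp RC ≈⟨ restrict-cong (opp C) (≐-sym (support-opp X′)) ⟩
                 restrictSigned (opp C) (support (opp X′)) ∎))
        where
        open ≃-Reasoning
        RC : SignedSubset E
        RC = restrictSigned C (support X′)

    induced-two : (∀ C′ → Circ C′ → UniqueUpToSign 𝒟 F′ C′) →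
                  ∀ X′ Y′ → Induced X′ → Induced Y′ → support X′ ≐ support Y′ → (X′ ≃ Y′) ⊎ (X′ ≃ opp Y′)
    induced-two unique X′ Y′ (circX′ , C , 𝒟C , lift (X′⊆C , C⊆X′F′ , X′≃C))
                             (_ , D , 𝒟D , lift (Y′⊆D , D⊆Y′F′ , Y′≃D)) X′≐Y′ =
      map⊎ (λ C≃D → begin X′ ≈⟨ X′≃C ⟩ RC ≈⟨ C≃D ⟩ RD ≈⟨ D≃Y′ ⟩ Y′ ∎)
           (λ C≃-D → begin X′ ≈⟨ X′≃C ⟩ RC ≈⟨ C≃-D ⟩ opp RD ≈⟨ opp-cong {P = RD} {Q = Y′} D≃Y′ ⟩
                              opp Y′ ∎)
           (unique (support X′) circX′ C D 𝒟C 𝒟D X′⊆C C⊆X′F′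
                   (λ a s → Y′⊆D a (proj₁ X′≐Y′ a s))
                   (λ a s → map⊎ (proj₂ X′≐Y′ a) id (D⊆Y′F′ a s)))
      where
      open ≃-Reasoning
      RC RD : SignedSubset E
      RC = restrictSigned C (support X′)
      RD = restrictSigned D (support X′)
      D≃Y′ : RD ≃ Y′
      D≃Y′ = begin RD ≈⟨ restrict-cong D X′≐Y′ ⟩ restrictSigned D (support Y′) ≈⟨ Y′≃D ⟨ Y′ ∎

    induced-signature : (∀ A B → Circ A → A ≐ B → Circ B) → (∀ C → 𝒟 C → 𝒟 (opp C)) →
                        (∀ C′ → Circ C′ → SignedLift 𝒟 F′ C′) →
                        (∀ C′ → Circ C′ → UniqueUpToSign 𝒟 F′ C′) →
                        IsSignature Circ Induced
    induced-signature resp 𝒟-opp lifts unique = record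
      { supp-circ  = λ _ → proj₁
      ; cover      = induced-cover resp lifts
      ; opp-closed = induced-opp resp 𝒟-opp
      ; two        = induced-two unique
      }

module ContractionDeletion (lem : LEM) {E : Set} (M : Matroid E) (X F G : Subset E)
                           (partition : IsPartition3 X F G) where
  open Classical lem
  open Matroid M
  open MatroidTheory lem M
  open Minor M X F G

  X∩F=∅ : Disjoint X F
  X∩F=∅ = proj₁ (proj₂ partition)

  XF : Subset E
  XF = X ∪ F

  XF∩G=∅ : Disjoint XF G
  XF∩G=∅ a (inj₁ Xa) = proj₁ (proj₂ (proj₂ partition)) a Xa
  XF∩G=∅ a (inj₂ Fa) = proj₂ (proj₂ (proj₂ partition)) a Fa

  BF : Subset E
  BF = proj₁ (basis-extension F I1 (λ _ ()))

  BF-basis : Basis F BF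
  BF-basis = proj₁ (proj₂ (basis-extension F I1 (λ _ ())))

  BF⊆F : BF ⊆ F
  BF⊆F = ⊆S BF-basis

  ∪BF-⊆XF : ∀ {K} → K ⊆ X → (K ∪ BF) ⊆ XF
  ∪BF-⊆XF K⊆X a = [ (λ Ka → inj₁ (K⊆X a Ka)) , (λ BFa → inj₂ (BF⊆F a BFa)) ]

  -- The independent sets of M* ∖ F, in the form in which contractInd uses them.
  Coind∖F : Subset E → Set₁
  Coind∖F K = restrictInd (dualInd (univ M) Ind) (univ M ∖ F) K × Lift (lsuc lzero) (K ⊆ (univ M ∖ F))

  cobase : Subset E → Subset E
  cobase B e = ¬ F e × ¬ B e

  coind∖F⁺ : ∀ {B K} → Base B → K ⊆ cobase B → Coind∖F K
  coind∖F⁺ {K = K} baseB K⊆cobase =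
    (lift K⊆E∖F , lift ⊆-univ , _ , Base⇒UnivBase baseB , lift λ e Ke → proj₂ (K⊆cobase e Ke)) ,
    lift K⊆E∖F
    where
    K⊆E∖F : K ⊆ (univ M ∖ F)
    K⊆E∖F e Ke = ∈-univ e , proj₁ (K⊆cobase e Ke)

  coind∖F⁻ : ∀ {K} → Coind∖F K → ∃ λ B → Base B × K ⊆ cobase B
  coind∖F⁻ ((_ , _ , B , univB , lift K∩B=∅) , lift K⊆E∖F) =
    B , UnivBase⇒Base univB , λ e Ke → proj₂ (K⊆E∖F e Ke) , K∩B=∅ e Ke

  cobase-maximal : ∀ {B} → Base B → BF ⊆ B → Maximal Coind∖F (cobase B)
  cobase-maximal {B} baseB BF⊆B = coind∖F⁺ baseB (λ _ c → c) , maximal-cobase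
    where
    maximal-cobase : ∀ K′ → Coind∖F K′ → cobase B ⊆ K′ → K′ ⊆ cobase B
    maximal-cobase K′ coindK′ cobase⊆K′ y K′y with coind∖F⁻ coindK′
    ... | B′ , baseB′ , K′⊆cobase′ = ¬Fy , ¬By
      where
      ¬Fy : ¬ F y
      ¬Fy = proj₁ (K′⊆cobase′ y K′y)
      ¬By : ¬ B y
      ¬By By with I3 (B ∖ ｛ y ｝) B′ (I2 _ B (λ _ → proj₁) (proj₁ baseB))
                     (base-∖-not-base baseB By) baseB′
      ... | w , B′w , ¬B-y-w , indB-y+w = ¬B-y-w (Bw , λ { refl → proj₂ (K′⊆cobase′ y K′y) B′w })
        where
        BFw⊆B-y+w : (BF ∪ ｛ w ｝) ⊆ ((B ∖ ｛ y ｝) ∪ ｛ w ｝)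
        BFw⊆B-y+w b (inj₁ BFb) = inj₁ (BF⊆B b BFb , λ { refl → ¬Fy (BF⊆F b BFb) })
        BFw⊆B-y+w b (inj₂ b≡w) = inj₂ b≡w
        Bw : B w
        Bw with lem (F w)
        ... | yes Fw = BF⊆B w (basis-closed BF-basis Fw (I2 _ _ BFw⊆B-y+w indB-y+w))
        ... | no ¬Fw = ¬¬-elim λ ¬Bw → proj₂ (K′⊆cobase′ w (cobase⊆K′ w (¬Fw , ¬Bw))) B′w

  maximal-coind-complement : ∀ {K B} → Maximal Coind∖F K → Base B → K ⊆ cobase B →
                             ∀ y → ¬ F y → ¬ K y → B y
  maximal-coind-complement (_ , maxK) baseB K⊆cobase y ¬Fy ¬Ky =
    ¬¬-elim λ ¬By → ¬Ky (maxK _ (coind∖F⁺ baseB (λ _ c → c)) K⊆cobase y (¬Fy , ¬By))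

  indN⁺ : ∀ {I} → I ⊆ X → Ind (I ∪ BF) → IndN I
  indN⁺ I⊆X indIBF with base-extension indIBF
  ... | B , baseB , IBF⊆B =
    lift I⊆X ,
    lift (λ e Ie → ∈-univ e , X∩F=∅ e (I⊆X e Ie)) ,
    cobase B , cobase-maximal baseB (λ b BFb → IBF⊆B b (inj₂ BFb)) ,
    lift λ e Ie cobase-e → proj₂ cobase-e (IBF⊆B e (inj₁ Ie))

  indN⁻ : ∀ {I} → IndN I → Ind (I ∪ BF)
  indN⁻ {I} (lift I⊆X , _ , K , maxK , lift I∩K=∅)
    with coind∖F⁻ (proj₁ maxK)
  ... | B , baseB , K⊆cobase
    with basis-extension (BF ∪ B) (independent BF-basis) (λ _ → inj₁)
  ... | B″ , basisB″ , BF⊆B″ = I2 _ B″ IBF⊆B″ (independent basisB″)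
    where
    baseB″ : Base B″
    baseB″ = basis-of-spanning⇒base basisB″ (λ _ → inj₂) baseB
    K⊆cobase″ : K ⊆ cobase B″
    K⊆cobase″ k Kk = proj₁ (K⊆cobase k Kk) ,
      λ B″k → [ (λ BFk → proj₁ (K⊆cobase k Kk) (BF⊆F k BFk)) , proj₂ (K⊆cobase k Kk) ] (⊆S basisB″ k B″k)
    IBF⊆B″ : (I ∪ BF) ⊆ B″
    IBF⊆B″ a (inj₁ Ia) =
      maximal-coind-complement maxK baseB″ K⊆cobase″ a (X∩F=∅ a (I⊆X a Ia)) (I∩K=∅ a Ia)
    IBF⊆B″ a (inj₂ BFa) = BF⊆B″ a BFa

  BaseN : Subset E → Set₁
  BaseN = Maximal (λ K → IndN K × Lift (lsuc lzero) (K ⊆ X))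

  baseN⁻ : ∀ {K} → BaseN K → Basis XF (K ∪ BF)
  baseN⁻ {K} ((indNK , lift K⊆X) , maxK) = record
    { independent = indN⁻ indNK
    ; ⊆S = ∪BF-⊆XF K⊆X
    ; maximal = maximal-KBF }
    where
    maximal-KBF : ∀ J → Ind J → J ⊆ XF → (K ∪ BF) ⊆ J → J ⊆ (K ∪ BF)
    maximal-KBF J indJ J⊆XF KBF⊆J j Jj with J⊆XF j Jj
    ... | inj₁ Xj = inj₁ (maxK (J ∩ X) (indN⁺ (λ _ → proj₂) (I2 _ J J∩X∪BF⊆J indJ) , lift (λ _ → proj₂))
                              (λ a Ka → KBF⊆J a (inj₁ Ka) , K⊆X a Ka) j (Jj , Xj))
      where
      J∩X∪BF⊆J : ((J ∩ X) ∪ BF) ⊆ J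
      J∩X∪BF⊆J a = [ proj₁ , (λ BFa → KBF⊆J a (inj₂ BFa)) ]
    ... | inj₂ Fj =
      inj₂ (basis-closed BF-basis Fj (I2 _ J (∪｛｝-⊆ (λ a BFa → KBF⊆J a (inj₂ BFa)) Jj) indJ))

  basis-XF-⊆-∪BF : ∀ {L K} → Basis XF L → BF ⊆ L → (L ∩ X) ⊆ K → L ⊆ (K ∪ BF)
  basis-XF-⊆-∪BF basisL BF⊆L L∩X⊆K l Ll with ⊆S basisL l Ll
  ... | inj₁ Xl = inj₁ (L∩X⊆K l (Ll , Xl))
  ... | inj₂ Fl = inj₂ (basis-closed BF-basis Fl (I2 _ _ (∪｛｝-⊆ BF⊆L Ll) (independent basisL)))

  baseN⁺ : ∀ {L} → Basis XF L → BF ⊆ L → BaseN (L ∩ X)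
  baseN⁺ {L} basisL BF⊆L =
    (indN⁺ (λ _ → proj₂) (I2 _ L (λ a → [ proj₁ , BF⊆L a ]) (independent basisL)) , lift (λ _ → proj₂)) ,
    λ K′ (indNK′ , lift K′⊆X) L∩X⊆K′ k K′k →
      maximal basisL _ (indN⁻ indNK′) (∪BF-⊆XF K′⊆X)
              (basis-XF-⊆-∪BF basisL BF⊆L L∩X⊆K′) k (inj₁ K′k) ,
      K′⊆X k K′k

  coindN⁺ : ∀ {D L} → D ⊆ X → Basis XF L → BF ⊆ L → Disjoint D L → dualInd X IndN D
  coindN⁺ D⊆X basisL BF⊆L D∩L=∅ =
    lift D⊆X , _ , baseN⁺ basisL BF⊆L , lift λ d Dd (Ld , _) → D∩L=∅ d Dd Ld

  coindN⁻ : ∀ {D} → dualInd X IndN D → ∃ λ L → Basis XF L × BF ⊆ L × Disjoint D L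
  coindN⁻ (lift D⊆X , K , baseK , lift D∩K=∅) =
    K ∪ BF , baseN⁻ baseK , (λ _ → inj₂) ,
    λ d Dd → [ D∩K=∅ d Dd , (λ BFd → X∩F=∅ d (D⊆X d Dd) (BF⊆F d BFd)) ]

  circuitN-dependent : ∀ {C′} → CircuitN C′ → ¬ Ind (C′ ∪ BF)
  circuitN-dependent (C′⊆X , ¬indN , _) ind = ¬indN (indN⁺ C′⊆X ind)

  circuitN-minimal : ∀ {C′ e} → CircuitN C′ → C′ e → Ind ((C′ ∖ ｛ e ｝) ∪ BF)
  circuitN-minimal {e = e} (_ , _ , minimal) C′e =
    indN⁻ (minimal _ (λ _ → proj₁) λ C′⊆C′-e → proj₂ (C′⊆C′-e e C′e) refl)

  circuitN-nonempty : ∀ {C′} → CircuitN C′ → ∃ C′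
  circuitN-nonempty circC′ = ¬¬-elim λ empty → circuitN-dependent circC′
    (I2 _ BF (λ a → [ (λ C′a → ⊥-elim (empty (a , C′a))) , id ]) (independent BF-basis))

  circuitN-lift : ∀ {C′} → CircuitN C′ → ∃ λ C₀ → Circuit M C₀ × C′ ⊆ C₀ × C₀ ⊆ (C′ ∪ F)
  circuitN-lift {C′} circC′ with circuitN-nonempty circC′
  ... | e , C′e = fundamental-circuit I e , fundamental-circuit-circuit indI depIe , C′⊆C₀ , C₀⊆C′F
    where
    I : Subset E
    I = (C′ ∖ ｛ e ｝) ∪ BF
    indI : Ind I
    indI = circuitN-minimal circC′ C′e
    C′BF⊆Ie : (C′ ∪ BF) ⊆ (I ∪ ｛ e ｝)
    C′BF⊆Ie a (inj₁ C′a) with lem (a ≡ e)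
    ... | yes a≡e = inj₂ a≡e
    ... | no a≢e = inj₁ (inj₁ (C′a , a≢e))
    C′BF⊆Ie a (inj₂ BFa) = inj₁ (inj₂ BFa)
    depIe : ¬ Ind (I ∪ ｛ e ｝)
    depIe indIe = circuitN-dependent circC′ (I2 _ _ C′BF⊆Ie indIe)
    C′⊆C₀ : C′ ⊆ fundamental-circuit I e
    C′⊆C₀ g C′g with lem (g ≡ e)
    ... | yes g≡e = inj₁ g≡e
    ... | no g≢e =
      fundamental-circuit⁺ (inj₁ (C′g , g≢e)) (I2 _ _ I-g+e⊆C′-g∪BF (circuitN-minimal circC′ C′g))
      where
      I-g+e⊆C′-g∪BF : ((I ∖ ｛ g ｝) ∪ ｛ e ｝) ⊆ ((C′ ∖ ｛ g ｝) ∪ BF)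
      I-g+e⊆C′-g∪BF a (inj₁ (inj₁ (C′a , _) , a≢g)) = inj₁ (C′a , a≢g)
      I-g+e⊆C′-g∪BF a (inj₁ (inj₂ BFa , _)) = inj₂ BFa
      I-g+e⊆C′-g∪BF a (inj₂ refl) = inj₁ (C′e , g≢e ∘ sym)
    C₀⊆C′F : fundamental-circuit I e ⊆ (C′ ∪ F)
    C₀⊆C′F a C₀a with fundamental-circuit-⊆ a C₀a
    ... | inj₁ (inj₁ (C′a , _)) = inj₁ C′a
    ... | inj₁ (inj₂ BFa) = inj₂ (BF⊆F a BFa)
    ... | inj₂ refl = inj₁ C′e

  circuitN-opposing-cocircuit : ∀ {C′ e f} → CircuitN C′ → C′ e → C′ f → e ≢ f →
                                ∃ λ U → Cocircuit M U × U f × (∀ a → U a → (C′ ∪ F) a → a ≡ e ⊎ a ≡ f)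
  circuitN-opposing-cocircuit {C′} {e} {f} circC′ C′e C′f e≢f
    with base-extension (circuitN-minimal circC′ C′e)
  ... | B , baseB , C′-e∪BF⊆B =
    fundamental-cocircuit B f , fundamental-cocircuit-cocircuit baseB Bf , inj₁ refl , meet
    where
    Bf : B f
    Bf = C′-e∪BF⊆B f (inj₁ (C′f , e≢f ∘ sym))
    U∩F=∅ : Disjoint (fundamental-cocircuit B f) F
    U∩F=∅ = fundamental-cocircuit-∩-span BF-basis (λ b BFb → C′-e∪BF⊆B b (inj₂ BFb))
                                          (X∩F=∅ f (proj₁ circC′ f C′f))
    meet : ∀ a → fundamental-cocircuit B f a → (C′ ∪ F) a → a ≡ e ⊎ a ≡ f
    meet a Ua (inj₂ Fa) = ⊥-elim (U∩F=∅ a Ua Fa)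
    meet a Ua (inj₁ C′a) with lem (a ≡ e)
    ... | yes a≡e = inj₁ a≡e
    ... | no a≢e = inj₂ (fundamental-cocircuit-∩-base Ua (C′-e∪BF⊆B a (inj₁ (C′a , a≢e))))

  cocircuitN-meets-bases : ∀ {U′ L} → CocircuitN U′ → Basis XF L → BF ⊆ L → ¬ Disjoint U′ L
  cocircuitN-meets-bases (U′⊆X , ¬coind , _) basisL BF⊆L U′∩L=∅ =
    ¬coind (coindN⁺ U′⊆X basisL BF⊆L U′∩L=∅)

  cocircuitN-minimal : ∀ {U′ D} → CocircuitN U′ → D ⊆ U′ → ¬ (U′ ⊆ D) →
                       ∃ λ L → Basis XF L × BF ⊆ L × Disjoint D L
  cocircuitN-minimal (_ , _ , minimal) D⊆U′ U′⊈D = coindN⁻ (minimal _ D⊆U′ U′⊈D)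

  cocircuitN-nonempty : ∀ {U′} → CocircuitN U′ → ∃ U′
  cocircuitN-nonempty cocircU′
    with basis-extension XF (independent BF-basis) (λ a BFa → inj₂ (BF⊆F a BFa))
  ... | L , basisL , BF⊆L =
    ¬¬-elim λ empty → cocircuitN-meets-bases cocircU′ basisL BF⊆L λ a U′a _ → empty (a , U′a)

  record IsolatingBasis (U′ : Subset E) (f : E) : Set₁ where
    field
      L      : Subset E
      basis  : Basis XF L
      BF⊆L   : BF ⊆ L
      Lf     : L f
      U′∩L⊆f : ∀ a → U′ a → L a → a ≡ f
      B      : Subset E
      base   : Base B
      L⊆B    : L ⊆ B

  cocircuitN-isolating-basis : ∀ {U′ f} → CocircuitN U′ → U′ f → IsolatingBasis U′ f
  cocircuitN-isolating-basis {U′} {f} cocircU′ U′f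
    with cocircuitN-minimal cocircU′ (λ _ → proj₁) (λ U′⊆U′-f → proj₂ (U′⊆U′-f f U′f) refl)
  ... | L , basisL , BF⊆L , U′-f∩L=∅
    with base-extension (independent basisL)
  ... | B , baseB , L⊆B = record
    { L = L ; basis = basisL ; BF⊆L = BF⊆L ; Lf = Lf ; U′∩L⊆f = U′∩L⊆f
    ; B = B ; base = baseB ; L⊆B = L⊆B }
    where
    U′∩L⊆f : ∀ a → U′ a → L a → a ≡ f
    U′∩L⊆f a U′a La = ¬¬-elim λ a≢f → U′-f∩L=∅ a (U′a , a≢f) La
    Lf : L f
    Lf = ¬¬-elim λ ¬Lf → cocircuitN-meets-bases cocircU′ basisL BF⊆L
           λ a U′a La → ¬Lf (subst L (U′∩L⊆f a U′a La) La)

  module CocircuitLift {U′ f} (cocircU′ : CocircuitN U′) (U′f : U′ f) where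
    open IsolatingBasis (cocircuitN-isolating-basis cocircU′ U′f)

    U : Subset E
    U = fundamental-cocircuit B f

    cocircU : Cocircuit M U
    cocircU = fundamental-cocircuit-cocircuit base (L⊆B f Lf)

    Xf : X f
    Xf = proj₁ cocircU′ f U′f

    U∩F=∅ : Disjoint U F
    U∩F=∅ = fundamental-cocircuit-∩-span BF-basis (λ b BFb → L⊆B b (BF⊆L b BFb)) (X∩F=∅ f Xf)

    U∩X⊆U′ : ∀ y → U y → X y → U′ y
    U∩X⊆U′ y Uy Xy with fundamental-cocircuit⁻ Uy
    ... | inj₁ refl = U′f
    ... | inj₂ (¬By , indB-f+y) =
      ¬¬-elim λ ¬U′y → cocircuitN-meets-bases cocircU′ basisL′ BF⊆L′ (U′∩L′=∅ ¬U′y)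
      where
      L′ : Subset E
      L′ = (L ∖ ｛ f ｝) ∪ ｛ y ｝
      basisL′ : Basis XF L′
      basisL′ = basis-exchange basis Lf (inj₁ Xy) (¬By ∘ L⊆B y)
                  (I2 _ _ (λ a → map⊎ (λ (La , a≢f) → L⊆B a La , a≢f) id) indB-f+y)
      BF⊆L′ : BF ⊆ L′
      BF⊆L′ b BFb = inj₁ (BF⊆L b BFb , λ { refl → X∩F=∅ b Xf (BF⊆F b BFb) })
      U′∩L′=∅ : ¬ U′ y → Disjoint U′ L′
      U′∩L′=∅ ¬U′y a U′a (inj₁ (La , a≢f)) = a≢f (U′∩L⊆f a U′a La)
      U′∩L′=∅ ¬U′y a U′a (inj₂ refl) = ¬U′y U′a

    U′⊆U : U′ ⊆ U
    U′⊆U with lem (U′ ⊆ (U ∩ X))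
    ... | yes U′⊆U∩X = λ a U′a → proj₁ (U′⊆U∩X a U′a)
    ... | no U′⊈U∩X with cocircuitN-minimal cocircU′ (λ a (Ua , Xa) → U∩X⊆U′ a Ua Xa) U′⊈U∩X
    ... | L′ , basisL′ , _ , U∩X∩L′=∅ with basis-completion basisL′ base
    ... | B′ , baseB′ , _ , B′⊆L′∪B∖XF =
      ⊥-elim (proj₁ (proj₂ cocircU) (lift ⊆-univ , B′ , Base⇒UnivBase baseB′ , lift U∩B′=∅))
      where
      U∩B′=∅ : Disjoint U B′
      U∩B′=∅ a Ua B′a with B′⊆L′∪B∖XF a B′a
      ... | inj₂ (Ba , ¬XFa) = ¬XFa (inj₁ (subst X (sym (fundamental-cocircuit-∩-base Ua Ba)) Xf))
      ... | inj₁ L′a with ⊆S basisL′ a L′a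
      ... | inj₁ Xa = U∩X∩L′=∅ a (Ua , Xa) L′a
      ... | inj₂ Fa = U∩F=∅ a Ua Fa

    U⊆U′G : U ⊆ (U′ ∪ G)
    U⊆U′G a Ua with proj₁ partition a
    ... | inj₁ Xa = inj₁ (U∩X⊆U′ a Ua Xa)
    ... | inj₂ (inj₁ Fa) = ⊥-elim (U∩F=∅ a Ua Fa)
    ... | inj₂ (inj₂ Ga) = inj₂ Ga

  cocircuitN-lift : ∀ {U′} → CocircuitN U′ → ∃ λ U → Cocircuit M U × U′ ⊆ U × U ⊆ (U′ ∪ G)
  cocircuitN-lift cocircU′ with cocircuitN-nonempty cocircU′
  ... | f , U′f = U , cocircU , U′⊆U , U⊆U′G
    where open CocircuitLift cocircU′ U′f

  cocircuitN-opposing-circuit : ∀ {U′ e f} → CocircuitN U′ → U′ e → U′ f → e ≢ f →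
                                ∃ λ C → Circuit M C × C f × (∀ a → C a → (U′ ∪ G) a → a ≡ e ⊎ a ≡ f)
  cocircuitN-opposing-circuit {U′} {e} {f} cocircU′ U′e U′f e≢f =
    fundamental-circuit B f , fundamental-circuit-circuit (proj₁ base) (¬Bf ∘ base-closed base) ,
    inj₁ refl , meet
    where
    open IsolatingBasis (cocircuitN-isolating-basis cocircU′ U′e)
    Xf : X f
    Xf = proj₁ cocircU′ f U′f
    ¬Bf : ¬ B f
    ¬Bf Bf = e≢f (sym (U′∩L⊆f f U′f (∩-⊆-basis basis L⊆B (proj₁ base) (inj₁ Xf) Bf)))
    meet : ∀ a → fundamental-circuit B f a → (U′ ∪ G) a → a ≡ e ⊎ a ≡ f
    meet a C₀a U′Ga with fundamental-circuit-⊆-basis basis L⊆B (inj₁ Xf) ¬Bf a C₀a | U′Ga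
    ... | inj₂ a≡f | _ = inj₂ a≡f
    ... | inj₁ La | inj₁ U′a = inj₁ (U′∩L⊆f a U′a La)
    ... | inj₁ La | inj₂ Ga = ⊥-elim (XF∩G=∅ a (⊆S basis a La) Ga)

module OrientedMinor (lem : LEM) {E : Set} (M : Matroid E) (𝒞 𝒞* : SignedSubset E → Set₁)
                     (oriented : IsOrthogonallyOriented M 𝒞 𝒞*)
                     (X F G : Subset E) (partition : IsPartition3 X F G) where
  open Minor M X F G
  open ContractionDeletion lem M X F G partition
  open SignedSubsets
  open IsOrthogonallyOriented oriented

  signed-circuitN-lift : ∀ {C′} → CircuitN C′ → SignedLift 𝒞 F C′
  signed-circuitN-lift = signed-lift 𝒞 F circSig ∘ circuitN-lift

  signed-cocircuitN-lift : ∀ {U′} → CocircuitN U′ → SignedLift 𝒞* G U′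
  signed-cocircuitN-lift = signed-lift 𝒞* G cocircSig ∘ cocircuitN-lift

  circuitN-unique : ∀ {C′} → CircuitN C′ → UniqueUpToSign 𝒞 F C′
  circuitN-unique {C′} circC′ = unique-up-to-sign 𝒞 F lem opposing
    where
    opposing : ∀ e f → C′ e → C′ f → e ≢ f → Σ (SignedSubset E) λ R →
               ∀ C → 𝒞 C → C′ ⊆ support C → support C ⊆ (C′ ∪ F) → Opposed C R e f
    opposing e f C′e C′f e≢f =
      let (U₀ , cocircU₀ , U₀f , meet) = circuitN-opposing-cocircuit circC′ C′e C′f e≢f
          (R , 𝒞*R , R⊆U₀ , U₀⊆R) = IsSignature.cover cocircSig U₀ cocircU₀
      in R , λ C 𝒞C C′⊆C C⊆C′F →
           orthogonal⇒opposed C R (orth C R 𝒞C 𝒞*R) (λ a Ca Ra → meet a (R⊆U₀ a Ra) (C⊆C′F a Ca))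
                              (C′⊆C f C′f) (U₀⊆R f U₀f)

  cocircuitN-unique : ∀ {U′} → CocircuitN U′ → UniqueUpToSign 𝒞* G U′
  cocircuitN-unique {U′} cocircU′ = unique-up-to-sign 𝒞* G lem opposing
    where
    opposing : ∀ e f → U′ e → U′ f → e ≢ f → Σ (SignedSubset E) λ R →
               ∀ U → 𝒞* U → U′ ⊆ support U → support U ⊆ (U′ ∪ G) → Opposed U R e f
    opposing e f U′e U′f e≢f =
      let (C₀ , circC₀ , C₀f , meet) = cocircuitN-opposing-circuit cocircU′ U′e U′f e≢f
          (R , 𝒞R , R⊆C₀ , C₀⊆R) = IsSignature.cover circSig C₀ circC₀
      in R , λ U 𝒞*U U′⊆U U⊆U′G → opposed-sym R U
           (orthogonal⇒opposed R U (orth R U 𝒞R 𝒞*U) (λ a Ra Ua → meet a (R⊆C₀ a Ra) (U⊆U′G a Ua))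
                               (C₀⊆R f C₀f) (U′⊆U f U′f))

  induced-circuit-signature : IsSignature CircuitN (inducedSig 𝒞)
  induced-circuit-signature =
    induced-signature CircuitN F 𝒞
      (IsCircuit-resp-≐ (restrictInd-⊆-closed dualInd-⊆-closed))
      (IsSignature.opp-closed circSig)
      (λ _ → signed-circuitN-lift)
      (λ _ → circuitN-unique)

  induced-cocircuit-signature : IsSignature CocircuitN (inducedCosig 𝒞*)
  induced-cocircuit-signature =
    induced-signature CocircuitN G 𝒞*
      (IsCircuit-resp-≐ dualInd-⊆-closed)
      (IsSignature.opp-closed cocircSig)
      (λ _ → signed-cocircuitN-lift)
      (λ _ → cocircuitN-unique)

lemma3p5 : LEM → {E : Set} (M : Matroid E) (𝒞 𝒞* : SignedSubset E → Set₁)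
    → IsOrthogonallyOriented M 𝒞 𝒞*
    → (X F G : Subset E) → IsPartition3 X F G
    → let open Minor M X F G in
      ((C' : Subset E) → CircuitN C' →
        (Σ (SignedSubset E) λ C → 𝒞 C × (C' ⊆ support C) × (support C ⊆ (C' ∪ F)))
        × ((C D : SignedSubset E) → 𝒞 C → 𝒞 D
           → (C' ⊆ support C) → (support C ⊆ (C' ∪ F))
           → (C' ⊆ support D) → (support D ⊆ (C' ∪ F))
           → (restrictSigned C C' ≃ restrictSigned D C')
             ⊎ (restrictSigned C C' ≃ opp (restrictSigned D C'))))
      × ((U' : Subset E) → CocircuitN U' →
        (Σ (SignedSubset E) λ U → 𝒞* U × (U' ⊆ support U) × (support U ⊆ (U' ∪ G)))
        × ((U V : SignedSubset E) → 𝒞* U → 𝒞* V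
           → (U' ⊆ support U) → (support U ⊆ (U' ∪ G))
           → (U' ⊆ support V) → (support V ⊆ (U' ∪ G))
           → (restrictSigned U U' ≃ restrictSigned V U')
             ⊎ (restrictSigned U U' ≃ opp (restrictSigned V U'))))
      × IsSignature CircuitN (inducedSig 𝒞)
      × IsSignature CocircuitN (inducedCosig 𝒞*)
lemma3p5 lem M 𝒞 𝒞* oriented X F G partition =
  (λ _ circC′ → signed-circuitN-lift circC′ , circuitN-unique circC′) ,
  (λ _ cocircU′ → signed-cocircuitN-lift cocircU′ , cocircuitN-unique cocircU′) ,
  induced-circuit-signature ,
  induced-cocircuit-signature
  where open OrientedMinor lem M 𝒞 𝒞* oriented X F G partition
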